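{- Let $G=(V,E)$ be a tree and $\mathcal{M}=(V,\mathcal{I})$ a matroid of rank at least $1$. Let $\mathcal{I}'$ be the family of edge sets $X'\subseteq E$ such that the connected components $V_1,\dots,V_{|X'|+1}$ of $G-X'$ admit elements $v_i\in V_i$ ($i=1,\dots,|X'|+1$) with $\{v_1,\dots,v_{|X'|+1}\}\in\mathcal{I}$. Then $\mathcal{I}'$ satisfies the matroid independence axioms: $\emptyset\in\mathcal{I}'$; if $X'\subseteq Y'\in\mathcal{I}'$ then $X'\in\mathcal{I}'$; and if $X',Y'\in\mathcal{I}'$ with $|X'|<|Y'|$ then there is $e\in Y'\setminus X'$ with $X'\cup\{e\}\in\mathcal{I}'$.
   Context: $G-X'$ denotes the graph obtained from $G$ by deleting the edges in $X'$. -}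

module Defs where

open import Data.Nat using (ℕ; _<_; _≤_)
open import Data.Fin using (Fin)
open import Data.Fin.Subset using (Subset; _∈_; _∉_; _⊆_; ⊥; ⊤; ∁; _∪_; ⁅_⁆; ∣_∣)
open import Data.Product using (Σ; ∃; _×_; _,_; proj₁; proj₂)
open import Data.List using (List; []; _∷_)
open import Data.List.Relation.Unary.Unique.Propositional using (Unique)
open import Relation.Binary.PropositionalEquality using (_≡_; _≢_)
open import Level using (Level; suc; _⊔_)

record IsMatroid {ℓ : Level} {k : ℕ} (I : Subset k → Set ℓ) : Set ℓ where
  field
    empty-indep : I ⊥
    down-closed : ∀ X Y → X ⊆ Y → I Y → I X
    exchange    : ∀ X Y → I X → I Y → ∣ X ∣ < ∣ Y ∣ →
                  Σ (Fin k) λ e → e ∈ Y × e ∉ X × I (X ∪ ⁅ e ⁆)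

RankAtLeast1 : ∀ {ℓ k} → (Subset k → Set ℓ) → Set ℓ
RankAtLeast1 {k = k} I = Σ (Subset k) λ X → I X × 1 ≤ ∣ X ∣

-- A (multi)graph on vertex set Fin n with edge set Fin m;
-- ends e gives the two endpoints of edge e.
Graph : ℕ → ℕ → Set
Graph n m = Fin m → Fin n × Fin n

-- Walks using only edges from S (S = ⊤: the graph itself, S = ∁ X': the graph G - X').
data Walk {n m : ℕ} (G : Graph n m) (S : Subset m) : Fin n → Fin n → Set where
  here : ∀ {u} → Walk G S u u
  fwd  : ∀ {v} e → e ∈ S → Walk G S (proj₂ (G e)) v → Walk G S (proj₁ (G e)) v
  bwd  : ∀ {v} e → e ∈ S → Walk G S (proj₁ (G e)) v → Walk G S (proj₂ (G e)) v

walkEdges : ∀ {n m} {G : Graph n m} {S u v} → Walk G S u v → List (Fin m)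
walkEdges here        = []
walkEdges (fwd e _ w) = e ∷ walkEdges w
walkEdges (bwd e _ w) = e ∷ walkEdges w

walkStarts : ∀ {n m} {G : Graph n m} {S u v} → Walk G S u v → List (Fin n)
walkStarts here              = []
walkStarts {u = u} (fwd e _ w) = u ∷ walkStarts w
walkStarts {u = u} (bwd e _ w) = u ∷ walkStarts w

IsCycle : ∀ {n m} {G : Graph n m} {S u} → Walk G S u u → Set
IsCycle w = walkEdges w ≢ [] × Unique (walkEdges w) × Unique (walkStarts w)

Connected : ∀ {n m} → Graph n m → Set
Connected {n} G = (u v : Fin n) → Walk G ⊤ u v

Acyclic : ∀ {n m} → Graph n m → Set
Acyclic {n} G = (u : Fin n) (w : Walk G ⊤ u u) → IsCycle w → Data.Empty.⊥
  where import Data.Empty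

IsTree : ∀ {n m} → Graph n m → Set
IsTree G = Connected G × Acyclic G

SameComp : ∀ {n m} → Graph n m → Subset m → Fin n → Fin n → Set
SameComp G X' u v = Walk G (∁ X') u v

-- T is a system of representatives: every vertex is in the component of some
-- element of T, and distinct elements of T lie in distinct components.
I' : ∀ {ℓ n m} → Graph n m → (Subset n → Set ℓ) → Subset m → Set ℓ
I' {n = n} G I X' =
  Σ (Subset n) λ T →
    I T
    × ((u : Fin n) → Σ (Fin n) λ t → t ∈ T × SameComp G X' u t)
    × ((t t′ : Fin n) → t ∈ T → t′ ∈ T → SameComp G X' t t′ → t ≡ t′)

{-# OPTIONS --safe #-}
module Submission where

-- Say T represents G − X if it meets every component of G − X exactly once, so that X ∈ I'
-- iff some independent T represents G − X. In a tree the two ends of an edge e ∈ X lie in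
-- different components of G − X, so restoring e merges exactly two components and one
-- representative can be dropped. By induction, sets representing G − X have |X| + 1 elements,
-- and I' is closed under subsets. For exchange, let T and T_Y be independent and represent
-- G − X and G − Y, with |T| < |T_Y|. Pick u ∈ T_Y ∖ T with T + u independent, and let t ∈ T
-- represent the component of u in G − X. If the path from u to t has an edge e ∈ Y, deleting e
-- separates u from t, so T + u represents G − (X + e). Otherwise u and t are joined in G − Y,
-- so t ∉ T_Y. Then T − t + u represents G − X and has fewer elements outside T_Y. Repeating,
-- the first case must eventually occur.

open import Defs
open import Data.Nat using (ℕ; suc; _<_; s≤s)
open import Data.Nat.Properties using (≤-<-trans)
open import Data.Nat.Induction using (<-wellFounded)
open import Induction.WellFounded using (Acc; acc)
open import Data.Fin using (Fin; zero; suc) renaming (_≟_ to _≟ᶠ_)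
open import Data.Fin.Subset
open import Data.Fin.Subset.Properties
open import Data.Vec using (_∷_; here; there)
open import Data.Product using (Σ; ∃; _×_; _,_; proj₁; proj₂)
open import Data.Sum using (_⊎_; inj₁; inj₂; [_,_]′)
open import Data.List using (List; []; _∷_)
open import Data.List.Relation.Unary.All as All using (All; []; _∷_)
open import Data.List.Relation.Unary.All.Properties using (¬Any⇒All¬)
open import Data.List.Relation.Unary.Any as Any using (Any)
open import Data.List.Relation.Unary.AllPairs using ([]; _∷_)
open import Data.List.Relation.Unary.Unique.Propositional using (Unique)
open import Data.List.Membership.Propositional using (find) renaming (_∈_ to _∈ˡ_)
open import Data.Empty using (⊥-elim)
open import Relation.Nullary using (¬_; yes; no; contradiction)
open import Relation.Binary.PropositionalEquality
  using (_≡_; _≢_; refl; sym; trans; cong; subst; subst₂; ≢-sym; module ≡-Reasoning)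
open import Function using (_∘_)
open import Level using (Level)

x∈p─q⇒x∉q : ∀ {n} {x : Fin n} (p q : Subset n) → x ∈ p ─ q → x ∉ q
x∈p─q⇒x∉q {x = zero}  (s ∷ p) (inside  ∷ q) ()
x∈p─q⇒x∉q {x = zero}  (s ∷ p) (outside ∷ q) _ ()
x∈p─q⇒x∉q {x = suc x} (s ∷ p) (t ∷ q) (there x∈) (there x∈q) = x∈p─q⇒x∉q p q x∈ x∈q

x∈p-y⇒x≢y : ∀ {n} {x y : Fin n} (p : Subset n) → x ∈ p - y → x ≢ y
x∈p-y⇒x≢y p x∈ = x∉⁅y⁆⇒x≢y (x∈p─q⇒x∉q p _ x∈)

x∈p⇒⁅x⁆⊆p : ∀ {n} {x : Fin n} {p : Subset n} → x ∈ p → ⁅ x ⁆ ⊆ p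
x∈p⇒⁅x⁆⊆p x∈p y∈⁅x⁆ = subst (_∈ _) (sym (x∈⁅y⁆⇒x≡y _ y∈⁅x⁆)) x∈p

x∈p∪⁅x⁆ : ∀ {n} {x : Fin n} (p : Subset n) → x ∈ p ∪ ⁅ x ⁆
x∈p∪⁅x⁆ {x = x} p = q⊆p∪q p ⁅ x ⁆ (x∈⁅x⁆ x)

Empty[p─q]⇒p⊆q : ∀ {n} {p q : Subset n} → Empty (p ─ q) → p ⊆ q
Empty[p─q]⇒p⊆q {q = q} empty {x} x∈p with x ∈? q
... | yes x∈q = x∈q
... | no  x∉q = ⊥-elim (empty (x , x∈p∧x∉q⇒x∈p─q x∈p x∉q))

q⊆p∧x∉q⇒q⊆p-x : ∀ {n} {x : Fin n} {p q : Subset n} → q ⊆ p → x ∉ q → q ⊆ p - x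
q⊆p∧x∉q⇒q⊆p-x q⊆p x∉q y∈q = x∈p∧x≢y⇒x∈p-y (q⊆p y∈q) λ { refl → x∉q y∈q }

p-x∪q⊆p∪q : ∀ {n} {x : Fin n} (p : Subset n) {q : Subset n} → (p - x) ∪ q ⊆ p ∪ q
p-x∪q⊆p∪q p {q} y∈ = [ p⊆p∪q q ∘ p─q⊆p p _ , q⊆p∪q p q ]′ (x∈p∪q⁻ (p - _) q y∈)

x∈∁p∧x≢y⇒x∈∁[p∪⁅y⁆] : ∀ {n} {x y : Fin n} {p : Subset n} → x ∈ ∁ p → x ≢ y → x ∈ ∁ (p ∪ ⁅ y ⁆)
x∈∁p∧x≢y⇒x∈∁[p∪⁅y⁆] {y = y} {p} x∈∁p x≢y = x∉p⇒x∈∁p λ x∈p∪⁅y⁆ →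
  [ x∈∁p⇒x∉p x∈∁p , (λ x∈⁅y⁆ → x≢y (x∈⁅y⁆⇒x≡y y x∈⁅y⁆)) ]′ (x∈p∪q⁻ p ⁅ y ⁆ x∈p∪⁅y⁆)

x∈∁[p-y]∧x≢y⇒x∈∁p : ∀ {n} {x y : Fin n} {p : Subset n} → x ∈ ∁ (p - y) → x ≢ y → x ∈ ∁ p
x∈∁[p-y]∧x≢y⇒x∈∁p x∈ x≢y = x∉p⇒x∈∁p (λ x∈p → x∈∁p⇒x∉p x∈ (x∈p∧x≢y⇒x∈p-y x∈p x≢y))

y∈∁[p-y] : ∀ {n} {y : Fin n} (p : Subset n) → y ∈ ∁ (p - y)
y∈∁[p-y] p = x∉p⇒x∈∁p (λ y∈p-y → x∈p-y⇒x≢y p y∈p-y refl)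

∣p∣≡1+∣p-x∣ : ∀ {n} {x : Fin n} {p : Subset n} → x ∈ p → ∣ p ∣ ≡ suc ∣ p - x ∣
∣p∣≡1+∣p-x∣ {x = zero}  {inside ∷ p}  here       = cong suc (cong ∣_∣ (sym (p─⊥≡p p)))
∣p∣≡1+∣p-x∣ {x = suc x} {inside ∷ p}  (there x∈) = cong suc (∣p∣≡1+∣p-x∣ x∈)
∣p∣≡1+∣p-x∣ {x = suc x} {outside ∷ p} (there x∈) = ∣p∣≡1+∣p-x∣ x∈

0<∣p∣⇒Nonempty : ∀ {n} {p : Subset n} → 0 < ∣ p ∣ → Nonempty p
0<∣p∣⇒Nonempty {n} {p} 0<∣p∣ with nonempty? p
... | yes ne  = ne
... | no  ¬ne with Empty-unique ¬ne
...   | refl = contradiction (subst (0 <_) (∣⊥∣≡0 n) 0<∣p∣) λ ()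

∣[p-y∪⁅x⁆]─q∣<∣p─q∣ : ∀ {n} {x y : Fin n} {p q : Subset n} → y ∈ p → y ∉ q → x ∈ q →
                      ∣ ((p - y) ∪ ⁅ x ⁆) ─ q ∣ < ∣ p ─ q ∣
∣[p-y∪⁅x⁆]─q∣<∣p─q∣ {x = x} {y} {p} {q} y∈p y∉q x∈q =
  ≤-<-trans (p⊆q⇒∣p∣≤∣q∣ ⊆[p─q]-y) (x∈p⇒∣p-x∣<∣p∣ (x∈p∧x∉q⇒x∈p─q y∈p y∉q))
  where
  ⊆[p─q]-y : ((p - y) ∪ ⁅ x ⁆) ─ q ⊆ (p ─ q) - y
  ⊆[p─q]-y z∈ with x∈p∪q⁻ (p - y) ⁅ x ⁆ (p─q⊆p _ q z∈)
  ... | inj₁ z∈p-y = x∈p∧x≢y⇒x∈p-y (x∈p∧x∉q⇒x∈p─q (p─q⊆p p _ z∈p-y) (x∈p─q⇒x∉q _ q z∈))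
                                   (x∈p-y⇒x≢y p z∈p-y)
  ... | inj₂ z∈⁅x⁆ = ⊥-elim (x∈p─q⇒x∉q _ q z∈ (subst (_∈ q) (sym (x∈⁅y⁆⇒x≡y x z∈⁅x⁆)) x∈q))

module Walks {n m : ℕ} (G : Graph n m) where
  open import Data.List.Membership.DecPropositional (_≟ᶠ_ {n}) using () renaming (_∈?_ to _∈ˡ?_)

  src tgt : Fin m → Fin n
  src e = proj₁ (G e)
  tgt e = proj₂ (G e)

  infixr 5 _++ʷ_
  _++ʷ_ : ∀ {S u v w} → Walk G S u v → Walk G S v w → Walk G S u w
  here       ++ʷ q = q
  fwd e e∈ p ++ʷ q = fwd e e∈ (p ++ʷ q)
  bwd e e∈ p ++ʷ q = bwd e e∈ (p ++ʷ q)

  reverseʷ : ∀ {S u v} → Walk G S u v → Walk G S v u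
  reverseʷ here         = here
  reverseʷ (fwd e e∈ p) = reverseʷ p ++ʷ bwd e e∈ here
  reverseʷ (bwd e e∈ p) = reverseʷ p ++ʷ fwd e e∈ here

  walkEdges⊆ : ∀ {S u v} (p : Walk G S u v) → All (_∈ S) (walkEdges p)
  walkEdges⊆ here         = []
  walkEdges⊆ (fwd e e∈ p) = e∈ ∷ walkEdges⊆ p
  walkEdges⊆ (bwd e e∈ p) = e∈ ∷ walkEdges⊆ p

  restrict : ∀ {S S′ u v} (p : Walk G S u v) → All (_∈ S′) (walkEdges p) → Walk G S′ u v
  restrict here        _          = here
  restrict (fwd e _ p) (e∈ ∷ es∈) = fwd e e∈ (restrict p es∈)
  restrict (bwd e _ p) (e∈ ∷ es∈) = bwd e e∈ (restrict p es∈)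

  restrict-walkEdges : ∀ {S S′ u v} (p : Walk G S u v) (es∈ : All (_∈ S′) (walkEdges p)) →
                       walkEdges (restrict p es∈) ≡ walkEdges p
  restrict-walkEdges here        _         = refl
  restrict-walkEdges (fwd e _ p) (_ ∷ es∈) = cong (e ∷_) (restrict-walkEdges p es∈)
  restrict-walkEdges (bwd e _ p) (_ ∷ es∈) = cong (e ∷_) (restrict-walkEdges p es∈)

  restrict-walkStarts : ∀ {S S′ u v} (p : Walk G S u v) (es∈ : All (_∈ S′) (walkEdges p)) →
                        walkStarts (restrict p es∈) ≡ walkStarts p
  restrict-walkStarts here        _         = refl
  restrict-walkStarts (fwd e _ p) (_ ∷ es∈) = cong (src e ∷_) (restrict-walkStarts p es∈)
  restrict-walkStarts (bwd e _ p) (_ ∷ es∈) = cong (tgt e ∷_) (restrict-walkStarts p es∈)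

  weaken : ∀ {S S′ u v} → S ⊆ S′ → Walk G S u v → Walk G S′ u v
  weaken S⊆S′ p = restrict p (All.map S⊆S′ (walkEdges⊆ p))

  Endpoint : Fin m → Fin n → Set
  Endpoint e c = c ≡ src e ⊎ c ≡ tgt e

  Joins : Fin m → Fin n → Fin n → Set
  Joins e a b = (a ≡ src e × b ≡ tgt e) ⊎ (a ≡ tgt e × b ≡ src e)

  endpoint-of-joined : ∀ {e a b c} → Joins e a b → Endpoint e c → c ≡ a ⊎ c ≡ b
  endpoint-of-joined (inj₁ (refl , refl)) (inj₁ refl) = inj₁ refl
  endpoint-of-joined (inj₁ (refl , refl)) (inj₂ refl) = inj₂ refl
  endpoint-of-joined (inj₂ (refl , refl)) (inj₁ refl) = inj₂ refl
  endpoint-of-joined (inj₂ (refl , refl)) (inj₂ refl) = inj₁ refl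

  avoid-or-touch : ∀ {S S′ u v} e → (∀ {i} → i ∈ S → i ≢ e → i ∈ S′) → Walk G S u v →
                   Walk G S′ u v ⊎
                   (∃ λ c → Endpoint e c × Walk G S′ u c) × (∃ λ c → Endpoint e c × Walk G S′ c v)
  avoid-or-touch e S⊆S′∪e here = inj₁ here
  avoid-or-touch e S⊆S′∪e (fwd e′ e′∈ p) with e′ ≟ᶠ e | avoid-or-touch e S⊆S′∪e p
  ... | yes refl | inj₁ p′           = inj₂ ((src e , inj₁ refl , here) , (tgt e , inj₂ refl , p′))
  ... | yes refl | inj₂ (_ , after)  = inj₂ ((src e , inj₁ refl , here) , after)
  ... | no  e′≢e | inj₁ p′           = inj₁ (fwd e′ (S⊆S′∪e e′∈ e′≢e) p′)
  ... | no  e′≢e | inj₂ ((c , c-end , before) , after) =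
    inj₂ ((c , c-end , fwd e′ (S⊆S′∪e e′∈ e′≢e) before) , after)
  avoid-or-touch e S⊆S′∪e (bwd e′ e′∈ p) with e′ ≟ᶠ e | avoid-or-touch e S⊆S′∪e p
  ... | yes refl | inj₁ p′           = inj₂ ((tgt e , inj₂ refl , here) , (src e , inj₁ refl , p′))
  ... | yes refl | inj₂ (_ , after)  = inj₂ ((tgt e , inj₂ refl , here) , after)
  ... | no  e′≢e | inj₁ p′           = inj₁ (bwd e′ (S⊆S′∪e e′∈ e′≢e) p′)
  ... | no  e′≢e | inj₂ ((c , c-end , before) , after) =
    inj₂ ((c , c-end , bwd e′ (S⊆S′∪e e′∈ e′≢e) before) , after)

  restrict-avoiding : ∀ {S S′ u v e} → (∀ {i} → i ∈ S → i ≢ e → i ∈ S′) →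
                      (p : Walk G S u v) → All (e ≢_) (walkEdges p) → Walk G S′ u v
  restrict-avoiding S⊆S′∪e p e∉ =
    restrict p (All.zipWith (λ (i∈ , e≢i) → S⊆S′∪e i∈ (≢-sym e≢i)) (walkEdges⊆ p , e∉))

  cut-at : ∀ {S S′ u v e} → (∀ {i} → i ∈ S → i ≢ e → i ∈ S′) →
           (p : Walk G S u v) → e ∈ˡ walkEdges p → Unique (walkEdges p) →
           ∃ λ a → ∃ λ b → Joins e a b × Walk G S′ u a × Walk G S′ b v
  cut-at S⊆S′∪e (fwd e _ p) (Any.here refl) (e∉ ∷ _) =
    src e , tgt e , inj₁ (refl , refl) , here , restrict-avoiding S⊆S′∪e p e∉
  cut-at S⊆S′∪e (bwd e _ p) (Any.here refl) (e∉ ∷ _) =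
    tgt e , src e , inj₂ (refl , refl) , here , restrict-avoiding S⊆S′∪e p e∉
  cut-at S⊆S′∪e (fwd e′ e′∈ p) (Any.there e∈p) (e′∉ ∷ unique) with cut-at S⊆S′∪e p e∈p unique
  ... | a , b , joins , before , after =
    a , b , joins , fwd e′ (S⊆S′∪e e′∈ (All.lookup e′∉ e∈p)) before , after
  cut-at S⊆S′∪e (bwd e′ e′∈ p) (Any.there e∈p) (e′∉ ∷ unique) with cut-at S⊆S′∪e p e∈p unique
  ... | a , b , joins , before , after =
    a , b , joins , bwd e′ (S⊆S′∪e e′∈ (All.lookup e′∉ e∈p)) before , after

  vertices : ∀ {S u v} → Walk G S u v → List (Fin n)
  vertices {u = u} here = u ∷ []
  vertices (fwd e _ p) = src e ∷ vertices p
  vertices (bwd e _ p) = tgt e ∷ vertices p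

  IsPath : ∀ {S u v} → Walk G S u v → Set
  IsPath p = Unique (vertices p)

  head∈vertices : ∀ {S u v} (p : Walk G S u v) → u ∈ˡ vertices p
  head∈vertices here        = Any.here refl
  head∈vertices (fwd _ _ _) = Any.here refl
  head∈vertices (bwd _ _ _) = Any.here refl

  last∈vertices : ∀ {S u v} (p : Walk G S u v) → v ∈ˡ vertices p
  last∈vertices here        = Any.here refl
  last∈vertices (fwd _ _ p) = Any.there (last∈vertices p)
  last∈vertices (bwd _ _ p) = Any.there (last∈vertices p)

  walkStarts⊆vertices : ∀ {S u v x} (p : Walk G S u v) → x ∈ˡ walkStarts p → x ∈ˡ vertices p
  walkStarts⊆vertices (fwd _ _ p) (Any.here refl) = Any.here refl
  walkStarts⊆vertices (fwd _ _ p) (Any.there x∈) = Any.there (walkStarts⊆vertices p x∈)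
  walkStarts⊆vertices (bwd _ _ p) (Any.here refl) = Any.here refl
  walkStarts⊆vertices (bwd _ _ p) (Any.there x∈) = Any.there (walkStarts⊆vertices p x∈)

  endpoints∈vertices : ∀ {S u v e} (p : Walk G S u v) → e ∈ˡ walkEdges p →
                       src e ∈ˡ vertices p × tgt e ∈ˡ vertices p
  endpoints∈vertices (fwd _ _ p) (Any.here refl) = Any.here refl , Any.there (head∈vertices p)
  endpoints∈vertices (bwd _ _ p) (Any.here refl) = Any.there (head∈vertices p) , Any.here refl
  endpoints∈vertices (fwd _ _ p) (Any.there e∈) =
    Any.there (proj₁ (endpoints∈vertices p e∈)) , Any.there (proj₂ (endpoints∈vertices p e∈))
  endpoints∈vertices (bwd _ _ p) (Any.there e∈) =
    Any.there (proj₁ (endpoints∈vertices p e∈)) , Any.there (proj₂ (endpoints∈vertices p e∈))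

  path-from : ∀ {S u v x} (p : Walk G S u v) → x ∈ˡ vertices p → IsPath p →
              Σ (Walk G S x v) IsPath
  path-from here         (Any.here refl) p-path       = here , p-path
  path-from (fwd e e∈ p) (Any.here refl) p-path       = fwd e e∈ p , p-path
  path-from (bwd e e∈ p) (Any.here refl) p-path       = bwd e e∈ p , p-path
  path-from (fwd _ _ p)  (Any.there x∈)  (_ ∷ p-path) = path-from p x∈ p-path
  path-from (bwd _ _ p)  (Any.there x∈)  (_ ∷ p-path) = path-from p x∈ p-path

  toPath : ∀ {S u v} → Walk G S u v → Σ (Walk G S u v) IsPath
  toPath here = here , [] ∷ []
  toPath (fwd e e∈ p) with toPath p
  ... | q , q-path with src e ∈ˡ? vertices q
  ...   | yes src∈ = path-from q src∈ q-path
  ...   | no  src∉ = fwd e e∈ q , ¬Any⇒All¬ _ src∉ ∷ q-path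
  toPath (bwd e e∈ p) with toPath p
  ... | q , q-path with tgt e ∈ˡ? vertices q
  ...   | yes tgt∈ = path-from q tgt∈ q-path
  ...   | no  tgt∉ = bwd e e∈ q , ¬Any⇒All¬ _ tgt∉ ∷ q-path

  path⇒unique-edges : ∀ {S u v} (p : Walk G S u v) → IsPath p → Unique (walkEdges p)
  path⇒unique-edges here _ = []
  path⇒unique-edges (fwd e _ p) (src∉ ∷ p-path) =
    All.tabulate (λ { e∈ refl → All.lookup src∉ (proj₁ (endpoints∈vertices p e∈)) refl })
    ∷ path⇒unique-edges p p-path
  path⇒unique-edges (bwd e _ p) (tgt∉ ∷ p-path) =
    All.tabulate (λ { e∈ refl → All.lookup tgt∉ (proj₂ (endpoints∈vertices p e∈)) refl })
    ∷ path⇒unique-edges p p-path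

  path⇒unique-last∷starts : ∀ {S u v} (p : Walk G S u v) → IsPath p → Unique (v ∷ walkStarts p)
  path⇒unique-last∷starts here _ = [] ∷ []
  path⇒unique-last∷starts (fwd e _ p) (src∉ ∷ p-path) with path⇒unique-last∷starts p p-path
  ... | last∉ ∷ starts-unique =
    (≢-sym (All.lookup src∉ (last∈vertices p)) ∷ last∉)
    ∷ All.tabulate (λ x∈ → All.lookup src∉ (walkStarts⊆vertices p x∈)) ∷ starts-unique
  path⇒unique-last∷starts (bwd e _ p) (tgt∉ ∷ p-path) with path⇒unique-last∷starts p p-path
  ... | last∉ ∷ starts-unique =
    (≢-sym (All.lookup tgt∉ (last∈vertices p)) ∷ last∉)
    ∷ All.tabulate (λ x∈ → All.lookup tgt∉ (walkStarts⊆vertices p x∈)) ∷ starts-unique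

  acyclic⇒bridge : Acyclic G → ∀ e → ¬ Walk G (∁ ⁅ e ⁆) (tgt e) (src e)
  acyclic⇒bridge acyclic e w with toPath w
  ... | q , q-path =
    acyclic (src e) (fwd e ∈⊤ (weaken ⊆⊤ q)) ((λ ()) , edges-unique , starts-unique)
    where
    edges-unique : Unique (e ∷ walkEdges (weaken ⊆⊤ q))
    edges-unique = subst (λ es → Unique (e ∷ es)) (sym (restrict-walkEdges q _))
      (All.map (λ i∈ e≡i → x∈∁p⇒x∉p i∈ (subst (_∈ ⁅ e ⁆) e≡i (x∈⁅x⁆ e))) (walkEdges⊆ q)
       ∷ path⇒unique-edges q q-path)
    starts-unique : Unique (src e ∷ walkStarts (weaken ⊆⊤ q))
    starts-unique = subst (λ vs → Unique (src e ∷ vs)) (sym (restrict-walkStarts q _))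
      (path⇒unique-last∷starts q q-path)

  acyclic⇒separated : Acyclic G → ∀ {X e a b} → e ∈ X → Joins e a b → ¬ Walk G (∁ X) a b
  acyclic⇒separated acyclic {X} {e} e∈X joins w = separated joins (weaken ∁X⊆∁⁅e⁆ w)
    where
    ∁X⊆∁⁅e⁆ : ∁ X ⊆ ∁ ⁅ e ⁆
    ∁X⊆∁⁅e⁆ = p⊆q⇒∁p⊇∁q (x∈p⇒⁅x⁆⊆p e∈X)
    separated : ∀ {a b} → Joins e a b → ¬ Walk G (∁ ⁅ e ⁆) a b
    separated (inj₁ (refl , refl)) w = acyclic⇒bridge acyclic e (reverseʷ w)
    separated (inj₂ (refl , refl)) w = acyclic⇒bridge acyclic e w

-- I' G I X unfolds to Σ T (I T × Represents G X T).
Covers : ∀ {n m} → Graph n m → Subset m → Subset n → Set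
Covers {n} G X T = (u : Fin n) → Σ (Fin n) λ t → t ∈ T × SameComp G X u t

Separated : ∀ {n m} → Graph n m → Subset m → Subset n → Set
Separated {n} G X T = (t t′ : Fin n) → t ∈ T → t′ ∈ T → SameComp G X t t′ → t ≡ t′

Represents : ∀ {n m} → Graph n m → Subset m → Subset n → Set
Represents G X T = Covers G X T × Separated G X T

module Components {n m : ℕ} (G : Graph n m) where
  open Walks G

  separated-⊆ : ∀ {X X′ T T′} → X ⊆ X′ → T′ ⊆ T → Separated G X T → Separated G X′ T′
  separated-⊆ X⊆X′ T′⊆T separated s s′ s∈ s′∈ s→s′ =
    separated s s′ (T′⊆T s∈) (T′⊆T s′∈) (weaken (p⊆q⇒∁p⊇∁q X⊆X′) s→s′)

  separated-∪⁅⁆ : ∀ {X T u} → Separated G X T → (∀ {s} → s ∈ T → ¬ SameComp G X s u) →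
                  Separated G X (T ∪ ⁅ u ⁆)
  separated-∪⁅⁆ {X} {T} {u} separated apart s s′ s∈ s′∈ s→s′
    with x∈p∪q⁻ T ⁅ u ⁆ s∈ | x∈p∪q⁻ T ⁅ u ⁆ s′∈
  ... | inj₁ s∈T   | inj₁ s′∈T   = separated s s′ s∈T s′∈T s→s′
  ... | inj₁ s∈T   | inj₂ s′∈⁅u⁆ =
    ⊥-elim (apart s∈T (subst (SameComp G X s) (x∈⁅y⁆⇒x≡y u s′∈⁅u⁆) s→s′))
  ... | inj₂ s∈⁅u⁆ | inj₁ s′∈T   =
    ⊥-elim (apart s′∈T (subst (SameComp G X s′) (x∈⁅y⁆⇒x≡y u s∈⁅u⁆) (reverseʷ s→s′)))
  ... | inj₂ s∈⁅u⁆ | inj₂ s′∈⁅u⁆ = trans (x∈⁅y⁆⇒x≡y u s∈⁅u⁆) (sym (x∈⁅y⁆⇒x≡y u s′∈⁅u⁆))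

  connected⇒SameComp-⊥ : Connected G → ∀ u v → SameComp G ⊥ u v
  connected⇒SameComp-⊥ connected u v = weaken (λ _ → x∉p⇒x∈∁p ∉⊥) (connected u v)

  represents-⊥ : Connected G → ∀ v → Represents G ⊥ ⁅ v ⁆
  represents-⊥ connected v =
    (λ u → v , x∈⁅x⁆ v , connected⇒SameComp-⊥ connected u v) ,
    (λ t t′ t∈ t′∈ _ → trans (x∈⁅y⁆⇒x≡y v t∈) (sym (x∈⁅y⁆⇒x≡y v t′∈)))

  represents-⊥⇒∣T∣≡1 : Connected G → Fin n → ∀ {T} → Represents G ⊥ T → ∣ T ∣ ≡ 1
  represents-⊥⇒∣T∣≡1 connected v {T} (covers , separated) with covers v
  ... | t , t∈T , _ = trans (cong ∣_∣ (⊆-antisym T⊆⁅t⁆ (x∈p⇒⁅x⁆⊆p t∈T))) (∣⁅x⁆∣≡1 t)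
    where
    T⊆⁅t⁆ : T ⊆ ⁅ t ⁆
    T⊆⁅t⁆ {t′} t′∈T = subst (_∈ ⁅ t ⁆)
      (sym (separated t′ t t′∈T t∈T (connected⇒SameComp-⊥ connected t′ t))) (x∈⁅x⁆ t)

  represents-swap : ∀ {X T t u} → Represents G X T → t ∈ T → SameComp G X u t →
                    Represents G X ((T - t) ∪ ⁅ u ⁆)
  represents-swap {X} {T} {t} {u} (covers , separated) t∈T u→t = covers′ , separated′
    where
    covers′ : Covers G X ((T - t) ∪ ⁅ u ⁆)
    covers′ v with covers v
    ... | t′ , t′∈T , v→t′ with t′ ≟ᶠ t
    ...   | yes refl = u , x∈p∪⁅x⁆ (T - t) , v→t′ ++ʷ reverseʷ u→t
    ...   | no  t′≢t = t′ , p⊆p∪q ⁅ u ⁆ (x∈p∧x≢y⇒x∈p-y t′∈T t′≢t) , v→t′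
    apart : ∀ {s} → s ∈ T - t → ¬ SameComp G X s u
    apart s∈ s→u = x∈p-y⇒x≢y T s∈ (separated _ t (p─q⊆p T _ s∈) t∈T (s→u ++ʷ u→t))
    separated′ : Separated G X ((T - t) ∪ ⁅ u ⁆)
    separated′ = separated-∪⁅⁆ (separated-⊆ ⊆-refl (p─q⊆p T _) separated) apart

  module _ (acyclic : Acyclic G) where

    represents-merge : ∀ {X T e} → e ∈ X → Represents G X T →
                       ∃ λ t → t ∈ T × Represents G (X - e) (T - t)
    represents-merge {X} {T} {e} e∈X (covers , separated)
      with covers (src e) | covers (tgt e)
    ... | tₛ , tₛ∈T , src→tₛ | tₜ , tₜ∈T , tgt→tₜ = tₜ , tₜ∈T , covers′ , separated′
      where
      ∁X⊆∁[X-e] : ∁ X ⊆ ∁ (X - e)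
      ∁X⊆∁[X-e] = p⊆q⇒∁p⊇∁q (p─q⊆p X ⁅ e ⁆)
      tₛ≢tₜ : tₛ ≢ tₜ
      tₛ≢tₜ refl = acyclic⇒separated acyclic e∈X (inj₁ (refl , refl)) (src→tₛ ++ʷ reverseʷ tgt→tₜ)
      covers′ : Covers G (X - e) (T - tₜ)
      covers′ u with covers u
      ... | t , t∈T , u→t with t ≟ᶠ tₜ
      ...   | yes refl = tₛ , x∈p∧x≢y⇒x∈p-y tₛ∈T tₛ≢tₜ ,
                         weaken ∁X⊆∁[X-e] (u→t ++ʷ reverseʷ tgt→tₜ)
                         ++ʷ bwd e (y∈∁[p-y] X) (weaken ∁X⊆∁[X-e] src→tₛ)
      ...   | no  t≢tₜ = t , x∈p∧x≢y⇒x∈p-y t∈T t≢tₜ , weaken ∁X⊆∁[X-e] u→t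
      touching⇒≡tₛ : ∀ {s c} → s ∈ T - tₜ → Endpoint e c → SameComp G X s c → s ≡ tₛ
      touching⇒≡tₛ s∈ (inj₁ refl) s→c = separated _ tₛ (p─q⊆p T _ s∈) tₛ∈T (s→c ++ʷ src→tₛ)
      touching⇒≡tₛ s∈ (inj₂ refl) s→c =
        ⊥-elim (x∈p-y⇒x≢y T s∈ (separated _ tₜ (p─q⊆p T _ s∈) tₜ∈T (s→c ++ʷ tgt→tₜ)))
      separated′ : Separated G (X - e) (T - tₜ)
      separated′ s s′ s∈ s′∈ s→s′ with avoid-or-touch e x∈∁[p-y]∧x≢y⇒x∈∁p s→s′
      ... | inj₁ s→s′ = separated s s′ (p─q⊆p T _ s∈) (p─q⊆p T _ s′∈) s→s′
      ... | inj₂ ((c , c-end , s→c) , (c′ , c′-end , c′→s′)) =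
        trans (touching⇒≡tₛ s∈ c-end s→c) (sym (touching⇒≡tₛ s′∈ c′-end (reverseʷ c′→s′)))

    represents-split : ∀ {X T t u e} → Represents G X T → t ∈ T →
                       (p : SameComp G X u t) → Unique (walkEdges p) → e ∈ˡ walkEdges p →
                       Represents G (X ∪ ⁅ e ⁆) (T ∪ ⁅ u ⁆)
    represents-split {X} {T} {t} {u} {e} (covers , separated) t∈T p p-trail e∈p
      with cut-at x∈∁p∧x≢y⇒x∈∁[p∪⁅y⁆] p e∈p p-trail
    ... | a , b , joins , u→a , b→t = covers′ , separated′
      where
      u↛t : ¬ SameComp G (X ∪ ⁅ e ⁆) u t
      u↛t u→t = acyclic⇒separated acyclic (x∈p∪⁅x⁆ X) joins (reverseʷ u→a ++ʷ u→t ++ʷ reverseʷ b→t)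
      covers′ : Covers G (X ∪ ⁅ e ⁆) (T ∪ ⁅ u ⁆)
      covers′ v with covers v
      ... | t′ , t′∈T , v→t′ with avoid-or-touch e x∈∁p∧x≢y⇒x∈∁[p∪⁅y⁆] v→t′
      ...   | inj₁ v→t′ = t′ , p⊆p∪q ⁅ u ⁆ t′∈T , v→t′
      ...   | inj₂ ((c , c-end , v→c) , _) with endpoint-of-joined joins c-end
      ...     | inj₁ refl = u , x∈p∪⁅x⁆ T , v→c ++ʷ reverseʷ u→a
      ...     | inj₂ refl = t , p⊆p∪q ⁅ u ⁆ t∈T , v→c ++ʷ b→t
      apart : ∀ {s} → s ∈ T → ¬ SameComp G (X ∪ ⁅ e ⁆) s u
      apart s∈T s→u with separated _ t s∈T t∈T (weaken (p⊆q⇒∁p⊇∁q (p⊆p∪q ⁅ e ⁆)) s→u ++ʷ p)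
      ... | refl = u↛t (reverseʷ s→u)
      separated′ : Separated G (X ∪ ⁅ e ⁆) (T ∪ ⁅ u ⁆)
      separated′ = separated-∪⁅⁆ (separated-⊆ (p⊆p∪q ⁅ e ⁆) ⊆-refl separated) apart

    represents-⊆ : ∀ {X Y T} → X ⊆ Y → Represents G Y T → ∃ λ T′ → T′ ⊆ T × Represents G X T′
    represents-⊆ {Y = Y} = go (<-wellFounded ∣ Y ∣)
      where
      go : ∀ {X Y T} → Acc _<_ ∣ Y ∣ → X ⊆ Y → Represents G Y T →
           ∃ λ T′ → T′ ⊆ T × Represents G X T′
      go {X} {Y} {T} (acc smaller) X⊆Y rep with nonempty? (Y ─ X)
      ... | no  Y─X-empty =
        T , ⊆-refl , subst (λ Z → Represents G Z T) (⊆-antisym (Empty[p─q]⇒p⊆q Y─X-empty) X⊆Y) rep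
      ... | yes (e , e∈Y─X) with represents-merge (p─q⊆p Y X e∈Y─X) rep
      ...   | t , _ , rep′ with go (smaller (x∈p⇒∣p-x∣<∣p∣ (p─q⊆p Y X e∈Y─X)))
                                   (q⊆p∧x∉q⇒q⊆p-x X⊆Y (x∈p─q⇒x∉q Y X e∈Y─X)) rep′
      ...     | T′ , T′⊆T-t , rep″ = T′ , p─q⊆p T _ ∘ T′⊆T-t , rep″

    -- v rules out the empty graph, where the empty set represents G − ⊥.
    module _ (connected : Connected G) (v : Fin n) where

      represents⇒∣T∣≡1+∣X∣ : ∀ {X T} → Represents G X T → ∣ T ∣ ≡ suc ∣ X ∣
      represents⇒∣T∣≡1+∣X∣ {X} = go (<-wellFounded ∣ X ∣)
        where
        open ≡-Reasoning
        go : ∀ {X T} → Acc _<_ ∣ X ∣ → Represents G X T → ∣ T ∣ ≡ suc ∣ X ∣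
        go {X} {T} (acc smaller) rep with nonempty? X
        ... | no ¬ne with Empty-unique ¬ne
        ...   | refl = trans (represents-⊥⇒∣T∣≡1 connected v rep) (cong suc (sym (∣⊥∣≡0 m)))
        go {X} {T} (acc smaller) rep | yes (e , e∈X) with represents-merge e∈X rep
        ...   | t , t∈T , rep′ = begin
          ∣ T ∣               ≡⟨ ∣p∣≡1+∣p-x∣ t∈T ⟩
          suc ∣ T - t ∣       ≡⟨ cong suc (go (smaller (x∈p⇒∣p-x∣<∣p∣ e∈X)) rep′) ⟩
          suc (suc ∣ X - e ∣) ≡⟨ cong suc (∣p∣≡1+∣p-x∣ e∈X) ⟨
          suc ∣ X ∣           ∎

module ComponentMatroid {ℓ : Level} {n m : ℕ} (G : Graph n m) (I : Subset n → Set ℓ)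
                    (tree : IsTree G) (M : IsMatroid I) where
  open Walks G
  open Components G
  open IsMatroid M

  connected : Connected G
  connected = proj₁ tree

  acyclic : Acyclic G
  acyclic = proj₂ tree

  I′-empty : ∀ v → I ⁅ v ⁆ → I' G I ⊥
  I′-empty v I⁅v⁆ = ⁅ v ⁆ , I⁅v⁆ , represents-⊥ connected v

  I′-down-closed : ∀ X Y → X ⊆ Y → I' G I Y → I' G I X
  I′-down-closed X Y X⊆Y (T , I-T , rep) with represents-⊆ acyclic X⊆Y rep
  ... | T′ , T′⊆T , rep′ = T′ , down-closed T′ T T′⊆T I-T , rep′

  Augmentation : Subset m → Subset m → Set ℓ
  Augmentation X Y = Σ (Fin m) λ e → e ∈ Y × e ∉ X × I' G I (X ∪ ⁅ e ⁆)

  module _ (v : Fin n) {X Y : Subset m} {TY : Subset n}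
           (I-TY : I TY) (repY : Represents G Y TY) (∣X∣<∣Y∣ : ∣ X ∣ < ∣ Y ∣) where

    ∣T∣<∣TY∣ : ∀ {T} → Represents G X T → ∣ T ∣ < ∣ TY ∣
    ∣T∣<∣TY∣ rep = subst₂ _<_ (sym (represents⇒∣T∣≡1+∣X∣ acyclic connected v rep))
                              (sym (represents⇒∣T∣≡1+∣X∣ acyclic connected v repY)) (s≤s ∣X∣<∣Y∣)

    Improvement : Subset n → Set ℓ
    Improvement T = ∃ λ T′ → I T′ × Represents G X T′ × ∣ T′ ─ TY ∣ < ∣ T ─ TY ∣

    swap-into-TY : ∀ {T t u} → I (T ∪ ⁅ u ⁆) → Represents G X T → u ∈ TY → u ∉ T → t ∈ T →
                   SameComp G X u t → SameComp G Y u t → Improvement T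
    swap-into-TY {T} {t} {u} I-T∪⁅u⁆ rep u∈TY u∉T t∈T u→t u→t-in-G-Y =
      (T - t) ∪ ⁅ u ⁆ , down-closed _ _ (p-x∪q⊆p∪q T) I-T∪⁅u⁆ , represents-swap rep t∈T u→t ,
      ∣[p-y∪⁅x⁆]─q∣<∣p─q∣ t∈T t∉TY u∈TY
      where
      t∉TY : t ∉ TY
      t∉TY t∈TY = u∉T (subst (_∈ T) (sym (proj₂ repY u t u∈TY t∈TY u→t-in-G-Y)) t∈T)

    augment-or-improve : ∀ {T} → I T → Represents G X T → Augmentation X Y ⊎ Improvement T
    augment-or-improve {T} I-T rep@(covers , _) with exchange T TY I-T I-TY (∣T∣<∣TY∣ rep)
    ... | u , u∈TY , u∉T , I-T∪⁅u⁆ with covers u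
    ...   | t , t∈T , u→t with toPath u→t
    ...     | p , p-path with Any.any? (_∈? Y) (walkEdges p)
    ...       | yes Y-edge-on-p =
      let e , e∈p , e∈Y = find Y-edge-on-p in
      inj₁ (e , e∈Y , x∈∁p⇒x∉p (All.lookup (walkEdges⊆ p) e∈p) , T ∪ ⁅ u ⁆ , I-T∪⁅u⁆ ,
            represents-split acyclic rep t∈T p (path⇒unique-edges p p-path) e∈p)
    ...       | no no-Y-edge =
      inj₂ (swap-into-TY I-T∪⁅u⁆ rep u∈TY u∉T t∈T u→t
              (restrict p (All.map x∉p⇒x∈∁p (¬Any⇒All¬ _ no-Y-edge))))

    augment : ∀ {T} → Acc _<_ ∣ T ─ TY ∣ → I T → Represents G X T → Augmentation X Y
    augment (acc smaller) I-T rep with augment-or-improve I-T rep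
    ... | inj₁ augmentation = augmentation
    ... | inj₂ (T′ , I-T′ , rep′ , closer) = augment (smaller closer) I-T′ rep′

  I′-exchange : Fin n → ∀ X Y → I' G I X → I' G I Y → ∣ X ∣ < ∣ Y ∣ → Augmentation X Y
  I′-exchange v X Y (T , I-T , rep) (TY , I-TY , repY) ∣X∣<∣Y∣ =
    augment v I-TY repY ∣X∣<∣Y∣ (<-wellFounded _) I-T rep

lemma7 : ∀ {ℓ : Level} {n m : ℕ} (G : Graph n m) (I : Subset n → Set ℓ) →
           IsTree G → IsMatroid I → RankAtLeast1 I →
           IsMatroid (I' G I)
lemma7 G I tree M (X₀ , I-X₀ , 0<∣X₀∣) with 0<∣p∣⇒Nonempty 0<∣X₀∣
... | v , v∈X₀ = record
  { empty-indep = I′-empty v (IsMatroid.down-closed M ⁅ v ⁆ X₀ (x∈p⇒⁅x⁆⊆p v∈X₀) I-X₀)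
  ; down-closed = I′-down-closed
  ; exchange    = I′-exchange v
  }
  where open ComponentMatroid G I tree M
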